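{- Let $\vec{x}$ be a finite sequence of integers of length $n\geq 3$ with $k(\vec{x})=n-1$. Then $g_b(\vec{x})=\max(\vec{x}(l(\vec{x})+2),\vec{x}(k(\vec{x})+1))$.
   Context: For a nonempty finite integer sequence $\vec{x}=\langle x_1,\ldots,x_n\rangle$, write $\vec{x}(i)=x_i$. Define $k(\vec{x})=n$ if $\vec{x}(1)>\vec{x}(2)>\cdots>\vec{x}(n)$; otherwise $k(\vec{x})$ is the least $k$ with $\vec{x}(k)\leq\vec{x}(k+1)$. Define $l(\vec{x})$ as the least integer $l$ with $1\leq l<k(\vec{x})$ such that $\vec{x}(l)>\vec{x}(l+1)+1$ and $\vec{x}(l+1)=\vec{x}(l+2)+1$, if such $l$ exists; otherwise $l(\vec{x})=k(\vec{x})-1$. The function $g_b$ on sequences $\langle x_1,\ldots,x_j\rangle$ is defined recursively: if $j\leq 3$ then $g_b(x_1,\ldots,x_j)=x_j$; otherwise, if $x_1=x_2+1$ or $x_2>x_3+1$ then $g_b(x_1,\ldots,x_j)=g_b(x_2,\ldots,x_j)$, else $g_b(x_1,\ldots,x_j)=\max\{x_3,x_j\}$. -}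

module Defs where

open import Data.Nat using (ℕ; zero; suc; _∸_)
open import Data.Integer using (ℤ; _+_; _<?_; _≤?_; _⊔_; +_)
import Data.Integer.Properties as ℤP
open import Data.List using (List; []; _∷_; length)
open import Data.Bool using (Bool; true; false; if_then_else_; _∧_; _∨_)
open import Relation.Nullary.Decidable using (⌊_⌋)

-- 1-indexed access x(i); out-of-range indices give 0 (never used in-range
-- in the statement below).
at : List ℤ → ℕ → ℤ
at []       _             = + 0
at (x ∷ xs) zero          = + 0
at (x ∷ xs) (suc zero)    = x
at (x ∷ xs) (suc (suc i)) = at xs (suc i)

lastZ : List ℤ → ℤ
lastZ []           = + 0
lastZ (x ∷ [])     = x
lastZ (x ∷ y ∷ xs) = lastZ (y ∷ xs)

-- k(x): n if x₁ > x₂ > ⋯ > xₙ, else least k with x(k) ≤ x(k+1).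
kf : List ℤ → ℕ
kf []           = zero
kf (x ∷ [])     = suc zero
kf (x ∷ y ∷ xs) = if ⌊ y <? x ⌋ then suc (kf (y ∷ xs)) else suc zero

-- the condition at l: x(l) > x(l+1)+1 and x(l+1) = x(l+2)+1
-- (requiring l+2 ≤ n so that x(l+2) exists)
lcond : List ℤ → ℕ → Bool
lcond xs l = ⌊ Data.Nat._≤?_ (suc (suc l)) (length xs) ⌋
           ∧ ⌊ (at xs (suc l) + + 1) <? at xs l ⌋
           ∧ ⌊ ℤP._≟_ (at xs (suc l)) (at xs (suc (suc l)) + + 1) ⌋

lsearch : List ℤ → ℕ → ℕ → ℕ → ℕ
lsearch xs d i zero    = d
lsearch xs d i (suc m) = if lcond xs i then i else lsearch xs d (suc i) m

-- l(x): least l with 1 ≤ l < k(x) satisfying the condition, else k(x) - 1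
lf : List ℤ → ℕ
lf xs = lsearch xs (kf xs ∸ 1) 1 (kf xs ∸ 1)

gb : List ℤ → ℤ
gb (x1 ∷ x2 ∷ x3 ∷ x4 ∷ xs) =
  if ⌊ ℤP._≟_ x1 (x2 + + 1) ⌋ ∨ ⌊ (x3 + + 1) <? x2 ⌋
  then gb (x2 ∷ x3 ∷ x4 ∷ xs)
  else x3 ⊔ lastZ (x4 ∷ xs)
gb xs = lastZ xs

-- While x₁ = x₂ + 1 or x₂ > x₃ + 1, g_b discards x₁; on a sequence that is
-- strictly decreasing up to position n − 1 these are exactly the cases in which
-- the defining condition of l fails at position 1, so l and k both drop by one
-- together with g_b's argument and induction applies.  When g_b stops instead,
-- x₁ > x₂ + 1 and x₂ = x₃ + 1, so l = 1 and g_b = max(x₃, xₙ) = max(x(l+2), x(k+1)).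
module Submission where

open import Defs
open import Data.Nat using (ℕ; _≤_; _∸_; _+_)
open import Data.Integer using (ℤ; _⊔_)
open import Data.List using (List; length)
open import Relation.Binary.PropositionalEquality using (_≡_)

open import Data.Nat using (zero; suc; s≤s; s≤s⁻¹; _≤?_)
import Data.Nat.Properties as ℕ
open import Data.Integer using (+_; _<_; _<?_) renaming (_+_ to _+ℤ_; _≤_ to _≤ℤ_)
import Data.Integer.Properties as ℤ
open import Data.Integer.Properties using () renaming (_≟_ to _≟ℤ_)
open import Data.List using ([]; _∷_)
open import Data.Bool using (true; false; not; _∨_)
open import Relation.Nullary using (yes; no)
open import Relation.Nullary.Decidable using (⌊_⌋)
open import Relation.Binary.PropositionalEquality using (refl; sym; cong; subst)
open import Data.Empty using (⊥-elim)
open import Data.Product using (_×_; _,_)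

i<j⇒i+1≤j : ∀ {i j : ℤ} → i < j → i +ℤ + 1 ≤ℤ j
i<j⇒i+1≤j {i} i<j = subst (_≤ℤ _) (ℤ.+-comm (+ 1) i) (ℤ.i<j⇒suc[i]≤j i<j)

at-length≡lastZ : ∀ (x : ℤ) xs → at (x ∷ xs) (length (x ∷ xs)) ≡ lastZ (x ∷ xs)
at-length≡lastZ x []       = refl
at-length≡lastZ x (y ∷ xs) = at-length≡lastZ y xs

kf-∷-∷ : ∀ {a b : ℤ} r → b < a → kf (a ∷ b ∷ r) ≡ suc (kf (b ∷ r))
kf-∷-∷ {a} {b} r b<a with b <? a
... | yes _   = refl
... | no  b≮a = ⊥-elim (b≮a b<a)

kf-descent : ∀ (a b : ℤ) r {n} → kf (a ∷ b ∷ r) ≡ suc (suc n) → b < a × kf (b ∷ r) ≡ suc n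
kf-descent a b r eq with b <? a | eq
... | yes b<a | kx = b<a , ℕ.suc-injective kx

≤?-suc : ∀ m n → ⌊ suc m ≤? suc n ⌋ ≡ ⌊ m ≤? n ⌋
≤?-suc m n with suc m ≤? suc n | m ≤? n
... | yes _         | yes _   = refl
... | no  _         | no  _   = refl
... | yes 1+m≤1+n   | no  m≰n = ⊥-elim (m≰n (s≤s⁻¹ 1+m≤1+n))
... | no  1+m≰1+n   | yes m≤n = ⊥-elim (1+m≰1+n (s≤s m≤n))

lcond-∷ : ∀ (x : ℤ) ys j → lcond (x ∷ ys) (suc (suc j)) ≡ lcond ys (suc j)
lcond-∷ x ys j rewrite ≤?-suc (suc (suc (suc j))) (length ys) = refl

lsearch-∷ : ∀ (x : ℤ) ys d j m →
  lsearch (x ∷ ys) (suc d) (suc (suc j)) m ≡ suc (lsearch ys d (suc j) m)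
lsearch-∷ x ys d j zero    = refl
lsearch-∷ x ys d j (suc m) rewrite lcond-∷ x ys j with lcond ys (suc j)
... | true  = refl
... | false = lsearch-∷ x ys d (suc j) m

lf-∷ : ∀ (x : ℤ) ys {L} → kf (x ∷ ys) ≡ suc (suc L) → kf ys ≡ suc L →
  lcond (x ∷ ys) 1 ≡ false → lf (x ∷ ys) ≡ suc (lf ys)
lf-∷ x ys {L} kx ky fails
  rewrite kx | ky | fails = lsearch-∷ x ys L 0 L

lf≡1 : ∀ xs {L} → kf xs ≡ suc (suc L) → lcond xs 1 ≡ true → lf xs ≡ 1
lf≡1 xs kx holds rewrite kx | holds = refl

lf-length3 : ∀ (a b c : ℤ) → kf (a ∷ b ∷ c ∷ []) ≡ 2 → lf (a ∷ b ∷ c ∷ []) ≡ 1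
lf-length3 a b c kx rewrite kx with lcond (a ∷ b ∷ c ∷ []) 1
... | true  = refl
... | false = refl

gb-drop-test≡not-lcond : ∀ {a b c : ℤ} r → b < a → c < b →
  (⌊ a ≟ℤ b +ℤ + 1 ⌋ ∨ ⌊ (c +ℤ + 1) <? b ⌋)
    ≡ not (lcond (a ∷ b ∷ c ∷ r) 1)
gb-drop-test≡not-lcond {a} {b} {c} r b<a c<b
  with a ≟ℤ b +ℤ + 1 | (b +ℤ + 1) <? a | (c +ℤ + 1) <? b | b ≟ℤ c +ℤ + 1
... | yes a≡b+1 | yes b+1<a | _ | _ = ⊥-elim (ℤ.<-irrefl (sym a≡b+1) b+1<a)
... | yes _ | no _ | _ | _ = refl
... | no a≢b+1 | no b+1≮a | _ | _ =
  ⊥-elim (b+1≮a (ℤ.≤∧≢⇒< (i<j⇒i+1≤j b<a) (λ e → a≢b+1 (sym e))))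
... | no _ | yes _ | yes c+1<b | yes b≡c+1 = ⊥-elim (ℤ.<-irrefl (sym b≡c+1) c+1<b)
... | no _ | yes _ | yes _ | no _ = refl
... | no _ | yes _ | no c+1≮b | yes _ = refl
... | no _ | yes _ | no c+1≮b | no b≢c+1 =
  ⊥-elim (b≢c+1 (ℤ.≤-antisym (ℤ.≮⇒≥ c+1≮b) (i<j⇒i+1≤j c<b)))

gb-descending : ∀ (a b c : ℤ) rest → kf (a ∷ b ∷ c ∷ rest) ≡ suc (suc (length rest)) →
  gb (a ∷ b ∷ c ∷ rest) ≡
    at (a ∷ b ∷ c ∷ rest) (suc (suc (lf (a ∷ b ∷ c ∷ rest))))
      ⊔ at (a ∷ b ∷ c ∷ rest) (suc (kf (a ∷ b ∷ c ∷ rest)))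
gb-descending a b c [] kx
  rewrite lf-length3 a b c kx | kx = sym (ℤ.⊔-idem c)
gb-descending a b c (d ∷ rest) kx
  with kf-descent a b (c ∷ d ∷ rest) kx
... | b<a , ky with kf-descent b c (d ∷ rest) ky
... | c<b , _
  rewrite gb-drop-test≡not-lcond (d ∷ rest) b<a c<b
  with lcond (a ∷ b ∷ c ∷ d ∷ rest) 1 in holds
... | false
  rewrite lf-∷ a (b ∷ c ∷ d ∷ rest) kx ky holds | kf-∷-∷ (c ∷ d ∷ rest) b<a
  = gb-descending b c d rest ky
... | true
  rewrite lf≡1 (a ∷ b ∷ c ∷ d ∷ rest) kx holds | kx
  = cong (c ⊔_) (sym (at-length≡lastZ d rest))

lemma2p1 : (xs : List ℤ) → 3 ≤ length xs → kf xs ≡ length xs ∸ 1 →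
           gb xs ≡ at xs (lf xs + 2) ⊔ at xs (kf xs + 1)
lemma2p1 (a ∷ b ∷ c ∷ rest) _ kx
  rewrite ℕ.+-comm (lf (a ∷ b ∷ c ∷ rest)) 2 | ℕ.+-comm (kf (a ∷ b ∷ c ∷ rest)) 1
  = gb-descending a b c rest kx
lemma2p1 []           ()             _
lemma2p1 (_ ∷ [])     (s≤s ())       _
lemma2p1 (_ ∷ _ ∷ []) (s≤s (s≤s ())) _
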